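{- Let $D$ be a finite set and $\varGamma$ a constraint language on $D$ such that for some total order $\le$ on $D$ we have $M_{D,\le}\in\mathrm{pPol}(\varGamma)$. Let $I$ be a $\varGamma_{\mathrm C}$-formula with $n$ variables. Then every connected component of the solution graph $G(I)$ has diameter $O(n|D|)$.
   Context: A constraint language on $D$ is a finite set of non-empty finitary relations on $D$. A $\varGamma_{\mathrm C}$-formula is a conjunction $I=\bigwedge_{i=1}^m R_i(\xi^i_1,\dots,\xi^i_{r_i})$ with $R_i\in\varGamma$ and each $\xi^i_j$ a variable or an element of $D$; a solution assigns values in $D$ to the variables so that each constraint tuple (constants evaluating to themselves) belongs to $R_i$. $G(I)$ has the solutions as vertices, two adjacent iff they differ in exactly one variable. $M_{D,\le}$ is the ternary partial operation with $M_{D,\le}(x,y,y)=M_{D,\le}(y,y,x)=x$ for $x\le y$ and undefined otherwise. A partial operation acts on tuples coordinatewise (defined iff all coordinates defined); it is a partial polymorphism of a relation if every defined result of applying it to tuples of the relation lies in the relation; $\mathrm{pPol}(\varGamma)$ is the set of partial polymorphisms of every relation in $\varGamma$. -}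

module Defs where

open import Level using (0ℓ)
open import Data.Nat using (ℕ; zero; suc)
open import Data.Fin using (Fin)
open import Data.Vec using (Vec; lookup)
open import Data.List using (List)
open import Data.List.Membership.Propositional using (_∈_)
open import Data.Product using (Σ; ∃; _×_; _,_; proj₁; proj₂)
open import Data.Sum using (_⊎_)
open import Relation.Binary.PropositionalEquality using (_≡_)
open import Relation.Nullary using (¬_)
open import Data.Nat using (_≤_)
open import Data.Fin using () renaming (_≟_ to _≟F_)

-- The domain D is Fin k (a finite set with k = |D| elements).

FRel : ℕ → Set₁
FRel k = Σ ℕ λ r → (Vec (Fin k) r → Set)

arity : ∀ {k} → FRel k → ℕ
arity = proj₁

holds : ∀ {k} (R : FRel k) → Vec (Fin k) (arity R) → Set
holds = proj₂

NonEmpty : ∀ {k} → FRel k → Set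
NonEmpty R = ∃ λ v → holds R v

record ConstraintLanguage (k : ℕ) : Set₁ where
  field
    rels     : List (FRel k)
    nonEmpty : ∀ {R} → R ∈ rels → NonEmpty R
open ConstraintLanguage public

-- Graph of the partial operation M_{D,≤}:  MGraph x y z w  means  M(x,y,z) is defined and equals w.
-- M(x,y,y) = x and M(y,y,x) = x whenever x ≤ y; undefined otherwise.
MGraph : ∀ {k} → (Fin k → Fin k → Set) → Fin k → Fin k → Fin k → Fin k → Set
MGraph _≤_ a b c d = (b ≡ c × a ≤ b × d ≡ a) ⊎ (a ≡ b × c ≤ a × d ≡ c)

IsPPolM : ∀ {k} → (Fin k → Fin k → Set) → FRel k → Set
IsPPolM {k} _≤_ R = ∀ (a b c d : Vec (Fin k) (arity R)) → holds R a → holds R b → holds R c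
                → (∀ j → MGraph _≤_ (lookup a j) (lookup b j) (lookup c j) (lookup d j))
                → holds R d

MInPPol : ∀ {k} → (Fin k → Fin k → Set) → ConstraintLanguage k → Set₁
MInPPol _≤_ Γ = ∀ {R} → R ∈ rels Γ → IsPPolM _≤_ R

-- Γ_C-formulas with n variables: a term is a variable or a constant of D.
data Term (k n : ℕ) : Set where
  var   : Fin n → Term k n
  const : Fin k → Term k n

record Constraint {k : ℕ} (Γ : ConstraintLanguage k) (n : ℕ) : Set₁ where
  field
    rel   : FRel k
    inΓ   : rel ∈ rels Γ
    args  : Vec (Term k n) (arity rel)
open Constraint public

Formula : ∀ {k} → ConstraintLanguage k → ℕ → Set₁
Formula Γ n = List (Constraint Γ n)

Assignment : ℕ → ℕ → Set
Assignment k n = Vec (Fin k) n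

evalTerm : ∀ {k n} → Assignment k n → Term k n → Fin k
evalTerm s (var x)   = lookup s x
evalTerm s (const d) = d

open import Data.Vec using (map)
open import Data.List.Relation.Unary.All using (All)

Satisfies : ∀ {k n} {Γ : ConstraintLanguage k} → Assignment k n → Constraint Γ n → Set
Satisfies s C = holds (rel C) (map (evalTerm s) (args C))

IsSolution : ∀ {k n} {Γ : ConstraintLanguage k} → Formula Γ n → Assignment k n → Set₁
IsSolution I s = All (Satisfies s) I

Adjacent : ∀ {k n} → Assignment k n → Assignment k n → Set
Adjacent {n = n} s t = Σ (Fin n) λ i → (¬ lookup s i ≡ lookup t i)
                                     × (∀ j → ¬ j ≡ i → lookup s j ≡ lookup t j)

data Walk {k n} {Γ : ConstraintLanguage k} (I : Formula Γ n)
     : Assignment k n → Assignment k n → ℕ → Set₁ where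
  here : ∀ {s} → IsSolution I s → Walk I s s zero
  step : ∀ {s u t ℓ} → IsSolution I s → Adjacent s u → Walk I u t ℓ → Walk I s t (suc ℓ)

SameComponent : ∀ {k n} {Γ : ConstraintLanguage k} → Formula Γ n → Assignment k n → Assignment k n → Set₁
SameComponent I s t = ∃ λ ℓ → Walk I s t ℓ

DiameterAtMost : ∀ {k n} {Γ : ConstraintLanguage k} → Formula Γ n → ℕ → Set₁
DiameterAtMost I B = ∀ s t → SameComponent I s t → ∃ λ ℓ → ℓ ≤ B × Walk I s t ℓ

-- A descent moves from a solution x to a solution x[i ≔ a] with a < x i.
-- Descents terminate, since each lowers the potential Σᵢ rank (x i) ≤ n|D|.
-- They are also locally confluent: if y = x[i ≔ a] and z = x[j ≔ b] are
-- solutions with i ≠ j, then M(y, x, z) = x[i ≔ a][j ≔ b] is a solution, being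
-- the image of three solutions under the partial polymorphism M. By Newman's
-- lemma descents are confluent, so the two ends of any walk in G(I) descend to
-- a common solution, and the two descending walks together have length at
-- most 2n|D|.
module Submission where

open import Defs
open import Data.Nat using (ℕ; _*_)
open import Data.Fin using (Fin)
open import Data.Product using (∃)
open import Relation.Binary.PropositionalEquality using (_≡_)
open import Relation.Binary.Structures using (IsTotalOrder)

open import Function using (_∘_)
import Data.Nat as ℕ
import Data.Nat.Properties as ℕₚ
open import Data.Nat.Induction using (<-wellFounded)
open import Data.Fin using (zero; suc; _≟_)
open import Data.Vec using (Vec; _∷_; lookup; map; _[_]≔_)
open import Data.Vec.Properties using (lookup∘update; lookup∘update′; []≔-commutes; []≔-idempotent)
open import Data.Vec.Relation.Binary.Pointwise.Extensional using (ext; Pointwise-≡⇒≡)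
open import Data.List using ([]; _∷_)
open import Data.List.Relation.Unary.All using ([]; _∷_)
open import Data.Product using (_×_; _,_)
open import Data.Sum using (inj₁; inj₂)
open import Relation.Nullary using (¬_; Dec; yes; no)
open import Relation.Binary.Core using (Rel)
open import Relation.Binary.Definitions using (Reflexive; Decidable; Trichotomous; tri<; tri≈; tri>)
open import Relation.Binary.Consequences using (total∧dec⇒dec)
open import Relation.Binary.PropositionalEquality using (_≢_; refl; sym; trans; subst; cong)
open import Relation.Binary.Construct.Closure.ReflexiveTransitive using (Star; ε; _◅_; _◅◅_)
open import Relation.Binary.Construct.Closure.Symmetric using (SymClosure; fwd; bwd)
open import Relation.Binary.Construct.Closure.Equivalence using (EqClosure)
open import Relation.Binary.Construct.Closure.Transitive using (Plus; [_]; _∼⁺⟨_⟩_)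
open import Relation.Binary.Rewriting using (Confluent; WeaklyConfluent; StronglyNormalizing; sn&wcr⇒cr)
open import Induction.WellFounded using (module Subrelation)
import Relation.Binary.Construct.On as On
import Relation.Binary.Construct.NonStrictToStrict as NonStrictToStrict

∑ : ∀ {m} → (Fin m → ℕ) → ℕ
∑ {ℕ.zero}  f = 0
∑ {ℕ.suc m} f = f zero ℕ.+ ∑ (f ∘ suc)

∑-mono-≤ : ∀ {m} {f g : Fin m → ℕ} → (∀ i → f i ℕ.≤ g i) → ∑ f ℕ.≤ ∑ g
∑-mono-≤ {ℕ.zero}  f≤g = ℕ.z≤n
∑-mono-≤ {ℕ.suc m} f≤g = ℕₚ.+-mono-≤ (f≤g zero) (∑-mono-≤ (f≤g ∘ suc))

∑-mono-< : ∀ {m} {f g : Fin m → ℕ} → (∀ i → f i ℕ.≤ g i) → ∀ a → f a ℕ.< g a → ∑ f ℕ.< ∑ g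
∑-mono-< f≤g zero    fa<ga = ℕₚ.+-mono-<-≤ fa<ga (∑-mono-≤ (f≤g ∘ suc))
∑-mono-< f≤g (suc a) fa<ga = ℕₚ.+-mono-≤-< (f≤g zero) (∑-mono-< (f≤g ∘ suc) a fa<ga)

∑-≤-* : ∀ {m} {f : Fin m → ℕ} {b} → (∀ i → f i ℕ.≤ b) → ∑ f ℕ.≤ m * b
∑-≤-* {ℕ.zero}  f≤b = ℕ.z≤n
∑-≤-* {ℕ.suc m} f≤b = ℕₚ.+-mono-≤ (f≤b zero) (∑-≤-* (f≤b ∘ suc))

indicator : ∀ {P : Set} → Dec P → ℕ
indicator (yes _) = 1
indicator (no _)  = 0

indicator≤1 : ∀ {P : Set} (p : Dec P) → indicator p ℕ.≤ 1
indicator≤1 (yes _) = ℕ.s≤s ℕ.z≤n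
indicator≤1 (no _)  = ℕ.z≤n

indicator-mono : ∀ {P Q : Set} → (P → Q) → (p : Dec P) (q : Dec Q) → indicator p ℕ.≤ indicator q
indicator-mono P⇒Q (no _)  q       = ℕ.z≤n
indicator-mono P⇒Q (yes _) (yes _) = ℕₚ.≤-refl
indicator-mono P⇒Q (yes p) (no ¬q) with () ← ¬q (P⇒Q p)

indicator-< : ∀ {P Q : Set} → ¬ P → Q → (p : Dec P) (q : Dec Q) → indicator p ℕ.< indicator q
indicator-< ¬p q (no _)  (yes _)  = ℕₚ.≤-refl
indicator-< ¬p q (yes p) _        with () ← ¬p p
indicator-< ¬p q _       (no ¬q)  with () ← ¬q q

module _ {a ℓ} {A : Set a} {_⟶_ : Rel A ℓ} where

  decreasing⇒stronglyNormalizing : (μ : A → ℕ) → (∀ {x y} → x ⟶ y → μ y ℕ.< μ x)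
                                 → StronglyNormalizing (Plus _⟶_)
  decreasing⇒stronglyNormalizing μ decreasing =
    Subrelation.wellFounded decreasing⁺ (On.wellFounded μ <-wellFounded)
    where
    decreasing⁺ : ∀ {x y} → Plus _⟶_ x y → μ y ℕ.< μ x
    decreasing⁺ [ x⟶y ]       = decreasing x⟶y
    decreasing⁺ (_ ∼⁺⟨ p ⟩ q) = ℕₚ.<-trans (decreasing⁺ q) (decreasing⁺ p)

  confluent⇒joinable : Confluent _⟶_ → ∀ {x y} → EqClosure _⟶_ x y
                     → ∃ λ z → Star _⟶_ x z × Star _⟶_ y z
  confluent⇒joinable conf ε = _ , ε , ε
  confluent⇒joinable conf (fwd x⟶u ◅ u~y) with confluent⇒joinable conf u~y
  ... | z , u↠z , y↠z = z , x⟶u ◅ u↠z , y↠z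
  confluent⇒joinable conf (bwd u⟶x ◅ u~y) with confluent⇒joinable conf u~y
  ... | z , u↠z , y↠z with conf (u⟶x ◅ ε) u↠z
  ...   | w , x↠w , z↠w = w , x↠w , y↠z ◅◅ z↠w

module _ {k n : ℕ} where

  adjacent-sym : ∀ {s t : Assignment k n} → Adjacent s t → Adjacent t s
  adjacent-sym (i , sᵢ≢tᵢ , agree) = i , sᵢ≢tᵢ ∘ sym , λ j j≢i → sym (agree j j≢i)

  update⇒adjacent : ∀ {x : Assignment k n} {i a} → lookup x i ≢ a → Adjacent x (x [ i ]≔ a)
  update⇒adjacent {x} {i} {a} xᵢ≢a =
    i , (λ eq → xᵢ≢a (trans eq (lookup∘update i x a))) ,
    λ j j≢i → sym (lookup∘update′ j≢i x a)

  adjacent⇒update : ∀ {s t : Assignment k n} ((i , _ , _) : Adjacent s t) → t ≡ s [ i ]≔ lookup t i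
  adjacent⇒update {s} {t} (i , _ , agree) = Pointwise-≡⇒≡ (ext pointwise)
    where
    pointwise : ∀ j → lookup t j ≡ lookup (s [ i ]≔ lookup t i) j
    pointwise j with j ≟ i
    ... | yes refl = sym (lookup∘update i s (lookup t i))
    ... | no j≢i   = trans (sym (agree j j≢i)) (sym (lookup∘update′ j≢i s (lookup t i)))

module _ {k n} {Γ : ConstraintLanguage k} {I : Formula Γ n} where

  walk-source : ∀ {s t ℓ} → Walk I s t ℓ → IsSolution I s
  walk-source (here s∈I)     = s∈I
  walk-source (step s∈I _ _) = s∈I

  walk-++ : ∀ {s u t ℓ m} → Walk I s u ℓ → Walk I u t m → Walk I s t (ℓ ℕ.+ m)
  walk-++ (here _)          q = q
  walk-++ (step s∈I s~u p) q = step s∈I s~u (walk-++ p q)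

  walk-reverse : ∀ {s t ℓ} → Walk I s t ℓ → Walk I t s ℓ
  walk-reverse (here s∈I) = here s∈I
  walk-reverse {s} {ℓ = ℕ.suc ℓ} (step {u = u} s∈I s~u p) =
    subst (Walk I _ _) (ℕₚ.+-comm ℓ 1) (walk-++ (walk-reverse p) (step (walk-source p) u~s (here s∈I)))
    where
    u~s : Adjacent u s
    u~s = adjacent-sym {s = s} {t = u} s~u

module _ {k} {_≤_ : Fin k → Fin k → Set} (≤-refl : Reflexive _≤_) where

  MGraph-updates : ∀ {n} (x : Vec (Fin k) n) {i j a b} → i ≢ j → a ≤ lookup x i → b ≤ lookup x j
    → ∀ v → MGraph _≤_ (lookup (x [ i ]≔ a) v) (lookup x v) (lookup (x [ j ]≔ b) v)
                       (lookup ((x [ i ]≔ a) [ j ]≔ b) v)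
  MGraph-updates x {i} {j} {a} {b} i≢j a≤xᵢ b≤xⱼ v with v ≟ j | v ≟ i
  ... | yes refl | _
      rewrite lookup∘update v (x [ i ]≔ a) b | lookup∘update v x b | lookup∘update′ (i≢j ∘ sym) x a
      = inj₂ (refl , b≤xⱼ , refl)
  ... | no v≢j | yes refl
      rewrite lookup∘update′ v≢j (x [ v ]≔ a) b | lookup∘update v x a | lookup∘update′ v≢j x b
      = inj₁ (refl , a≤xᵢ , refl)
  ... | no v≢j | no v≢i
      rewrite lookup∘update′ v≢j (x [ i ]≔ a) b | lookup∘update′ v≢i x a | lookup∘update′ v≢j x b
      = inj₁ (refl , ≤-refl , refl)

module _ {k} {Γ : ConstraintLanguage k} {_≤_ : Fin k → Fin k → Set}
         (≤-refl : Reflexive _≤_) (M∈pPol : MInPPol _≤_ Γ) where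

  private
    MGraph-map : ∀ {A : Set} {f g h e : A → Fin k}
               → (∀ τ → MGraph _≤_ (f τ) (g τ) (h τ) (e τ))
               → ∀ {r} (τs : Vec A r) j
               → MGraph _≤_ (lookup (map f τs) j) (lookup (map g τs) j)
                            (lookup (map h τs) j) (lookup (map e τs) j)
    MGraph-map M (τ ∷ τs) zero    = M τ
    MGraph-map M (τ ∷ τs) (suc j) = MGraph-map M τs j

  solutions-closed-under-M : ∀ {n} (I : Formula Γ n) {x y z w : Assignment k n}
    → IsSolution I x → IsSolution I y → IsSolution I z
    → (∀ v → MGraph _≤_ (lookup x v) (lookup y v) (lookup z v) (lookup w v))
    → IsSolution I w
  solutions-closed-under-M []      []         []         []         M = []
  solutions-closed-under-M (C ∷ I) (Cx ∷ Ix) (Cy ∷ Iy) (Cz ∷ Iz) M =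
    M∈pPol (inΓ C) _ _ _ _ Cx Cy Cz (MGraph-map M-term (args C))
    ∷ solutions-closed-under-M I Ix Iy Iz M
    where
    M-term : ∀ τ → MGraph _≤_ (evalTerm _ τ) (evalTerm _ τ) (evalTerm _ τ) (evalTerm _ τ)
    M-term (var v)   = M v
    M-term (const d) = inj₁ (refl , ≤-refl , refl)

module Rank {k} {_≤_ : Fin k → Fin k → Set} (isTotalOrder : IsTotalOrder _≡_ _≤_) where

  open IsTotalOrder isTotalOrder using (isPartialOrder; antisym; total; reflexive)
  open NonStrictToStrict _≡_ _≤_ public using (_<_; <⇒≤; <⇒≉; <-irrefl)

  <-trans : ∀ {a b c} → a < b → b < c → a < c
  <-trans = NonStrictToStrict.<-trans _≡_ _≤_ isPartialOrder

  <-trichotomous : Trichotomous _≡_ _<_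
  <-trichotomous = NonStrictToStrict.<-trichotomous _≡_ _≤_ sym _≟_ antisym total

  _<?_ : Decidable _<_
  _<?_ = NonStrictToStrict.<-decidable _≡_ _≤_ _≟_ (total∧dec⇒dec reflexive antisym total _≟_)

  rank : Fin k → ℕ
  rank a = ∑ λ c → indicator (c <? a)

  rank-mono-< : ∀ {a b} → a < b → rank a ℕ.< rank b
  rank-mono-< {a} {b} a<b =
    ∑-mono-< (λ c → indicator-mono (λ c<a → <-trans c<a a<b) (c <? a) (c <? b))
             a (indicator-< (<-irrefl refl) a<b (a <? a) (a <? b))

  rank≤ : ∀ a → rank a ℕ.≤ k
  rank≤ a = subst (rank a ℕ.≤_) (ℕₚ.*-identityʳ k) (∑-≤-* (λ c → indicator≤1 (c <? a)))

module Descent {k} {Γ : ConstraintLanguage k} {_≤_ : Fin k → Fin k → Set}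
               (isTotalOrder : IsTotalOrder _≡_ _≤_) (M∈pPol : MInPPol _≤_ Γ)
               {n} (I : Formula Γ n) where

  open IsTotalOrder isTotalOrder using () renaming (refl to ≤-refl)
  open Rank isTotalOrder

  data _⟶_ (x y : Assignment k n) : Set₁ where
    lower : ∀ i {a} → a < lookup x i → y ≡ x [ i ]≔ a → IsSolution I x → IsSolution I y → x ⟶ y

  potential : Assignment k n → ℕ
  potential x = ∑ (rank ∘ lookup x)

  potential≤ : ∀ x → potential x ℕ.≤ n * k
  potential≤ x = ∑-≤-* (rank≤ ∘ lookup x)

  potential-decreases : ∀ {x y} → x ⟶ y → potential y ℕ.< potential x
  potential-decreases {x} (lower i {a} a<xᵢ refl _ _) = ∑-mono-< pointwise i rank-lowered
    where
    rank-lowered : rank (lookup (x [ i ]≔ a) i) ℕ.< rank (lookup x i)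
    rank-lowered rewrite lookup∘update i x a = rank-mono-< a<xᵢ
    pointwise : ∀ v → rank (lookup (x [ i ]≔ a) v) ℕ.≤ rank (lookup x v)
    pointwise v with v ≟ i
    ... | yes refl = ℕₚ.<⇒≤ rank-lowered
    ... | no v≢i   = ℕₚ.≤-reflexive (cong rank (lookup∘update′ v≢i x a))

  private
    relower : ∀ {x : Assignment k n} {i a b} → a < b
            → IsSolution I (x [ i ]≔ b) → IsSolution I (x [ i ]≔ a) → (x [ i ]≔ b) ⟶ (x [ i ]≔ a)
    relower {x} {i} {a} {b} a<b =
      lower i (subst (a <_) (sym (lookup∘update i x b)) a<b) (sym ([]≔-idempotent x i))

  ⟶-weaklyConfluent : WeaklyConfluent _⟶_
  ⟶-weaklyConfluent {x} (lower i {a} a<xᵢ refl x∈I y∈I) (lower j {b} b<xⱼ refl _ z∈I) with i ≟ j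
  ... | no i≢j =
    _ , lower j b<yⱼ refl y∈I w∈I ◅ ε , lower i a<zᵢ ([]≔-commutes x i j i≢j) z∈I w∈I ◅ ε
    where
    b<yⱼ : b < lookup (x [ i ]≔ a) j
    b<yⱼ = subst (b <_) (sym (lookup∘update′ (i≢j ∘ sym) x a)) b<xⱼ
    a<zᵢ : a < lookup (x [ j ]≔ b) i
    a<zᵢ = subst (a <_) (sym (lookup∘update′ i≢j x b)) a<xᵢ
    w∈I : IsSolution I ((x [ i ]≔ a) [ j ]≔ b)
    w∈I = solutions-closed-under-M {_≤_ = _≤_} ≤-refl M∈pPol I y∈I x∈I z∈I
            (MGraph-updates {_≤_ = _≤_} ≤-refl x i≢j (<⇒≤ a<xᵢ) (<⇒≤ b<xⱼ))
  ... | yes refl with <-trichotomous a b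
  ...   | tri< a<b _ _ = _ , ε , relower a<b z∈I y∈I ◅ ε
  ...   | tri≈ _ refl _ = _ , ε , ε
  ...   | tri> _ _ b<a = _ , relower b<a y∈I z∈I ◅ ε , ε

  ⟶-confluent : Confluent _⟶_
  ⟶-confluent = sn&wcr⇒cr (decreasing⇒stronglyNormalizing potential potential-decreases)
                           ⟶-weaklyConfluent

  adjacent⇒step : ∀ {s t} → IsSolution I s → IsSolution I t → Adjacent s t → SymClosure _⟶_ s t
  adjacent⇒step {s} {t} s∈I t∈I s~t@(i , sᵢ≢tᵢ , _) with <-trichotomous (lookup t i) (lookup s i)
  ... | tri< tᵢ<sᵢ _ _ = fwd (lower i tᵢ<sᵢ (adjacent⇒update s~t) s∈I t∈I)
  ... | tri≈ _ tᵢ≡sᵢ _ with () ← sᵢ≢tᵢ (sym tᵢ≡sᵢ)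
  ... | tri> _ _ sᵢ<tᵢ =
    bwd (lower i sᵢ<tᵢ (adjacent⇒update (adjacent-sym {s = s} {t = t} s~t)) t∈I s∈I)

  walk⇒eqClosure : ∀ {s t ℓ} → Walk I s t ℓ → EqClosure _⟶_ s t
  walk⇒eqClosure (here _)          = ε
  walk⇒eqClosure (step s∈I s~u p) = adjacent⇒step s∈I (walk-source p) s~u ◅ walk⇒eqClosure p

  descent⇒walk : ∀ {x y} → IsSolution I x → Star _⟶_ x y
               → ∃ λ ℓ → ℓ ℕ.+ potential y ℕ.≤ potential x × Walk I x y ℓ
  descent⇒walk x∈I ε = 0 , ℕₚ.≤-refl , here x∈I
  descent⇒walk {x} x∈I (x⟶y@(lower i a<xᵢ refl _ y∈I) ◅ y↠z) with descent⇒walk y∈I y↠z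
  ... | ℓ , ℓ+pz≤py , y⇝z =
    ℕ.suc ℓ , ℕₚ.≤-trans (ℕ.s≤s ℓ+pz≤py) (potential-decreases x⟶y) ,
    step x∈I (update⇒adjacent {x = x} (<⇒≉ a<xᵢ ∘ sym)) y⇝z

  descent⇒short-walk : ∀ {x y} → IsSolution I x → Star _⟶_ x y
                     → ∃ λ ℓ → ℓ ℕ.≤ n * k × Walk I x y ℓ
  descent⇒short-walk {x} x∈I x↠y with descent⇒walk x∈I x↠y
  ... | ℓ , ℓ+py≤px , x⇝y =
    ℓ , ℕₚ.≤-trans (ℕₚ.m≤m+n ℓ _) (ℕₚ.≤-trans ℓ+py≤px (potential≤ x)) , x⇝y

  diameter≤2nk : DiameterAtMost I (2 * n * k)
  diameter≤2nk s t (_ , s⇝t) with confluent⇒joinable ⟶-confluent (walk⇒eqClosure s⇝t)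
  ... | u , s↠u , t↠u
      with descent⇒short-walk (walk-source s⇝t) s↠u
         | descent⇒short-walk (walk-source (walk-reverse s⇝t)) t↠u
  ... | ℓ , ℓ≤nk , s⇝u | m , m≤nk , t⇝u =
    ℓ ℕ.+ m , subst (ℓ ℕ.+ m ℕ.≤_) nk+nk≡2nk (ℕₚ.+-mono-≤ ℓ≤nk m≤nk) ,
    walk-++ s⇝u (walk-reverse t⇝u)
    where
    nk+nk≡2nk : n * k ℕ.+ n * k ≡ 2 * n * k
    nk+nk≡2nk = trans (cong (n * k ℕ.+_) (sym (ℕₚ.+-identityʳ (n * k)))) (sym (ℕₚ.*-assoc 2 n k))

corollary43 : ∃ λ (c : ℕ) →
    ∀ (k : ℕ) (Γ : ConstraintLanguage k) (_≤_ : Fin k → Fin k → Set)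
    → IsTotalOrder _≡_ _≤_
    → MInPPol _≤_ Γ
    → ∀ (n : ℕ) (I : Formula Γ n)
    → DiameterAtMost I (c * n * k)
corollary43 = 2 , λ k Γ _≤_ isTotalOrder M∈pPol n I → Descent.diameter≤2nk isTotalOrder M∈pPol I
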